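{- Let $l$ be an odd positive integer and $t$ a positive integer. Then for every $n$ there exists a collection of pairwise vertex-disjoint subgraphs of $Q_n$, each isomorphic to $(P_l)^t$, that covers all but at most $O(n^{t-1})$ vertices of $Q_n$ (the implied constant depending only on $l$ and $t$).
   Context: $Q_n$ is the $n$-dimensional hypercube on $\{0,1\}^n$; $P_l$ is the path on $l$ vertices. For graphs $G_1,G_2$ the Cartesian product $G_1\times G_2$ has vertex set $V(G_1)\times V(G_2)$, with $(u_1,u_2)\sim(v_1,v_2)$ iff either $u_1=v_1$ and $u_2v_2\in E(G_2)$, or $u_2=v_2$ and $u_1v_1\in E(G_1)$; $G^t$ is the product of $t$ copies of $G$. The copies here need not be induced subgraphs. -}

module Defs where

open import Data.Nat using (ℕ; zero; suc)
open import Data.Bool using (Bool; true; false)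
open import Data.Fin using (Fin; toℕ)
open import Data.Vec using (Vec; []; _∷_; lookup)
open import Data.Vec.Properties using (≡-dec)
open import Data.List using (List; []; _∷_; [_]; map; concatMap; filter; length; allFin)
open import Data.List.Relation.Unary.Any using (Any; any?)
open import Data.Product using (Σ; _×_)
open import Data.Sum using (_⊎_)
open import Relation.Nullary using (¬_; ¬?)
open import Relation.Binary.PropositionalEquality using (_≡_; _≢_)
import Data.Bool.Properties as BoolP
import Data.Fin.Properties as FinP

-- Cartesian product power G^t of a graph with vertex type V and adjacency adj:
-- vertices are t-tuples; u ~ v iff they differ in exactly one coordinate i,
-- where the i-th coordinates are adjacent in G.
PowAdj : {V : Set} → (V → V → Set) → (t : ℕ) → Vec V t → Vec V t → Set
PowAdj adj t u v =
  Σ (Fin t) λ i → adj (lookup u i) (lookup v i) × (∀ j → j ≢ i → lookup u j ≡ lookup v j)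

QVertex : ℕ → Set
QVertex n = Vec Bool n

QAdj : (n : ℕ) → QVertex n → QVertex n → Set
QAdj n = PowAdj (λ a b → a ≢ b) n

PAdj : (l : ℕ) → Fin l → Fin l → Set
PAdj l a b = (suc (toℕ a) ≡ toℕ b) ⊎ (suc (toℕ b) ≡ toℕ a)

PPowVertex : ℕ → ℕ → Set
PPowVertex l t = Vec (Fin l) t

PPowAdj : (l t : ℕ) → PPowVertex l t → PPowVertex l t → Set
PPowAdj l t = PowAdj (PAdj l) t

-- A (not necessarily induced) copy of (P_l)^t in Q_n: an injective map on
-- vertices sending edges to edges.
record Copy (l t n : ℕ) : Set where
  field
    f        : PPowVertex l t → QVertex n
    injective : ∀ x y → f x ≡ f y → x ≡ y
    edges    : ∀ x y → PPowAdj l t x y → QAdj n (f x) (f y)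
open Copy public

PairwiseDisjoint : {l t n k : ℕ} → (Fin k → Copy l t n) → Set
PairwiseDisjoint {k = k} cs =
  ∀ (i j : Fin k) → i ≢ j → ∀ x y → f (cs i) x ≢ f (cs j) y

allVecs : {A : Set} → List A → (n : ℕ) → List (Vec A n)
allVecs xs zero = [ [] ]
allVecs xs (suc n) = concatMap (λ a → map (a ∷_) (allVecs xs n)) xs

allQ : (n : ℕ) → List (QVertex n)
allQ n = allVecs (true ∷ false ∷ []) n

allPPow : (l t : ℕ) → List (PPowVertex l t)
allPPow l t = allVecs (allFin l) t

uncovered : {l t n k : ℕ} → (Fin k → Copy l t n) → ℕ
uncovered {l} {t} {n} {k} cs =
  length (filter
    (λ v → ¬? (any? (λ i → any? (λ x → ≡-dec BoolP._≟_ (f (cs i) x) v) (allPPow l t)) (allFin k)))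
    (allQ n))

-- Since l is odd, 2^a = K l + 1 for some a ≥ 1. A Gray code lists Q_a along a Hamiltonian path,
-- which cuts into K copies of P_l and one leftover vertex e. In Q_(a+m) = Q_a × Q_m, the products of
-- these K paths with a tiling of Q_m by copies of (P_l)^s tile (Q_a − e) × Q_m by copies of (P_l)^(s+1),
-- and {e} × Q_m is tiled by copies of (P_l)^(s+1) recursively. So the numbers B_t(m) of vertices left
-- uncovered satisfy B_(s+1)(a+m) ≤ 2^a B_s(m) + B_(s+1)(m), B_0 = 0 and B_t(m) ≤ 2^m for m < a, which
-- gives B_t(n) ≤ 2^(at) (n/a + 1)^(t-1).

module Submission where

open import Defs
open import Data.Bool using (Bool; true; false; _xor_)
open import Data.Bool.Properties using (xor-assoc; xor-same) renaming (_≟_ to _≟ᵇ_)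
open import Data.Empty using (⊥; ⊥-elim)
open import Data.Fin using (Fin; zero; suc; toℕ; fromℕ<; combine; remQuot; splitAt; join; _↑ˡ_; _↑ʳ_)
import Data.Fin.Properties as Finₚ
open import Data.List as List using (List; []; _∷_; length; filter; cartesianProductWith; concatMap; allFin)
import Data.List.Properties as Listₚ
open import Data.List.Relation.Binary.Subset.Propositional using (_⊆_)
open import Data.List.Membership.Propositional using (_∈_)
open import Data.List.Membership.Propositional.Properties
  using (∈-∃++; ∈-++⁻; ∈-++⁺ˡ; ∈-++⁺ʳ; ∈-map⁺; ∈-filter⁻; ∈-allFin; ∈-cartesianProductWith⁺)
import Data.List.Relation.Unary.All as All
open import Data.List.Relation.Unary.AllPairs using ([]; _∷_)
open import Data.List.Relation.Unary.Any as Any using (Any; here; there; any?)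
open import Data.List.Relation.Unary.Unique.Propositional using (Unique)
import Data.List.Relation.Unary.Unique.Propositional.Properties as Uniqueₚ
open import Data.Maybe using (Maybe; just; nothing)
open import Data.Maybe.Properties using (just-injective)
open import Data.Nat
  using (ℕ; zero; suc; _+_; _*_; _^_; _∸_; _%_; _/_; _≤_; _<_; z≤n; s≤s; s≤s⁻¹; NonZero; >-nonZero)
open import Data.Nat.Properties
open import Data.Nat.Coprimality using (Coprime; coprime-divisor)
open import Data.Nat.Divisibility using (_∣_; divides; ∣⇒≤; n∣m⇒m%n≡0; 0∣⇒≡0)
open import Data.Nat.DivMod using (m≡m%n+[m/n]*n; m%n<n; m/n*n≡m; m/n≤m)
open import Data.Nat.Tactic.RingSolver using (solve-∀)
open import Data.Product using (Σ; _×_; _,_; proj₁; proj₂)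
open import Data.Sum using (_⊎_; inj₁; inj₂)
open import Data.Vec using (Vec; []; _∷_; _++_; lookup; tabulate; replicate; take; drop)
import Data.Vec.Properties as Vecₚ
open import Function using (_∘_)
open import Relation.Binary.Definitions using (Symmetric)
open import Relation.Binary.PropositionalEquality
open import Relation.Nullary using (¬_; Dec; ¬?; yes; no; contradiction)

private
  variable
    A B C : Set
    R : A → A → Set
    m n : ℕ

-- PowAdj by recursion on the vectors, so that it interacts well with _++_.
Adjᵛ : (A → A → Set) → Vec A n → Vec A n → Set
Adjᵛ R []       []       = ⊥
Adjᵛ R (x ∷ xs) (y ∷ ys) = (R x y × xs ≡ ys) ⊎ (x ≡ y × Adjᵛ R xs ys)

lookup-extensional : (xs ys : Vec A n) → (∀ i → lookup xs i ≡ lookup ys i) → xs ≡ ys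
lookup-extensional xs ys eq = begin
  xs                   ≡⟨ Vecₚ.tabulate∘lookup xs ⟨
  tabulate (lookup xs) ≡⟨ Vecₚ.tabulate-cong eq ⟩
  tabulate (lookup ys) ≡⟨ Vecₚ.tabulate∘lookup ys ⟩
  ys                   ∎
  where open ≡-Reasoning

Adjᵛ⇒PowAdj : (u v : Vec A n) → Adjᵛ R u v → PowAdj R n u v
Adjᵛ⇒PowAdj []       []       ()
Adjᵛ⇒PowAdj (x ∷ xs) (y ∷ ys) (inj₁ (r , refl)) =
  zero , r , λ { zero 0≢0 → ⊥-elim (0≢0 refl) ; (suc j) _ → refl }
Adjᵛ⇒PowAdj (x ∷ xs) (y ∷ ys) (inj₂ (refl , adj)) with Adjᵛ⇒PowAdj xs ys adj
... | i , r , rest = suc i , r , λ { zero _ → refl ; (suc j) j≢i → rest j (j≢i ∘ cong suc) }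

PowAdj⇒Adjᵛ : (u v : Vec A n) → PowAdj R n u v → Adjᵛ R u v
PowAdj⇒Adjᵛ (x ∷ xs) (y ∷ ys) (zero , r , rest) =
  inj₁ (r , lookup-extensional xs ys (λ j → rest (suc j) (λ ())))
PowAdj⇒Adjᵛ (x ∷ xs) (y ∷ ys) (suc i , r , rest) =
  inj₂ (rest zero (λ ()) ,
        PowAdj⇒Adjᵛ xs ys (i , r , λ j j≢i → rest (suc j) (j≢i ∘ Finₚ.suc-injective)))

Adjᵛ-sym : Symmetric R → Symmetric (Adjᵛ {n = n} R)
Adjᵛ-sym sym-R {[]}     {[]}     ()
Adjᵛ-sym sym-R {x ∷ xs} {y ∷ ys} (inj₁ (r , refl))   = inj₁ (sym-R r , refl)
Adjᵛ-sym sym-R {x ∷ xs} {y ∷ ys} (inj₂ (refl , adj)) = inj₂ (refl , Adjᵛ-sym sym-R adj)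

Adjᵛ-++ˡ : (u u′ : Vec A m) (w : Vec A n) → Adjᵛ R u u′ → Adjᵛ R (u ++ w) (u′ ++ w)
Adjᵛ-++ˡ []      []       w ()
Adjᵛ-++ˡ (x ∷ u) (y ∷ u′) w (inj₁ (r , refl))   = inj₁ (r , refl)
Adjᵛ-++ˡ (x ∷ u) (y ∷ u′) w (inj₂ (refl , adj)) = inj₂ (refl , Adjᵛ-++ˡ u u′ w adj)

Adjᵛ-++ʳ : (u : Vec A m) (w w′ : Vec A n) → Adjᵛ R w w′ → Adjᵛ R (u ++ w) (u ++ w′)
Adjᵛ-++ʳ []      w w′ adj = adj
Adjᵛ-++ʳ (x ∷ u) w w′ adj = inj₂ (refl , Adjᵛ-++ʳ u w w′ adj)

take-++ : (u : Vec A m) (w : Vec A n) → take m (u ++ w) ≡ u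
take-++ {m = m} u w = Vecₚ.++-injectiveˡ (take m (u ++ w)) u (Vecₚ.take++drop≡id m (u ++ w))

drop-++ : (u : Vec A m) (w : Vec A n) → drop m (u ++ w) ≡ w
drop-++ {m = m} u w = Vecₚ.++-injectiveʳ (take m (u ++ w)) u (Vecₚ.take++drop≡id m (u ++ w))

concatMap≡cartesianProductWith : (f : A → B → C) (xs : List A) (ys : List B) →
  concatMap (λ x → List.map (f x) ys) xs ≡ cartesianProductWith f xs ys
concatMap≡cartesianProductWith f []       ys = refl
concatMap≡cartesianProductWith f (x ∷ xs) ys =
  cong (List.map (f x) ys List.++_) (concatMap≡cartesianProductWith f xs ys)

length-cartesianProductWith : (f : A → B → C) (xs : List A) (ys : List B) →
  length (cartesianProductWith f xs ys) ≡ length xs * length ys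
length-cartesianProductWith f []       ys = refl
length-cartesianProductWith f (x ∷ xs) ys = begin
  length (List.map (f x) ys List.++ cartesianProductWith f xs ys)
    ≡⟨ Listₚ.length-++ (List.map (f x) ys) ⟩
  length (List.map (f x) ys) + length (cartesianProductWith f xs ys)
    ≡⟨ cong₂ _+_ (Listₚ.length-map (f x) ys) (length-cartesianProductWith f xs ys) ⟩
  length ys + length xs * length ys ∎
  where open ≡-Reasoning

allVecs-suc : (xs : List A) (n : ℕ) → allVecs xs (suc n) ≡ cartesianProductWith _∷_ xs (allVecs xs n)
allVecs-suc xs n = concatMap≡cartesianProductWith _∷_ xs (allVecs xs n)

∈-allVecs : {xs : List A} → (∀ x → x ∈ xs) → (v : Vec A n) → v ∈ allVecs xs n
∈-allVecs every []      = here refl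
∈-allVecs {xs = xs} every (x ∷ v) = subst (x ∷ v ∈_) (sym (allVecs-suc xs _))
  (∈-cartesianProductWith⁺ _∷_ (every x) (∈-allVecs every v))

allVecs-unique : {xs : List A} → Unique xs → (n : ℕ) → Unique (allVecs xs n)
allVecs-unique xs! zero = All.[] ∷ []
allVecs-unique {xs = xs} xs! (suc n) = subst Unique (sym (allVecs-suc xs n))
  (Uniqueₚ.cartesianProductWith⁺ _∷_ Vecₚ.∷-injective xs! (allVecs-unique xs! n))

length-allVecs : (xs : List A) (n : ℕ) → length (allVecs xs n) ≡ length xs ^ n
length-allVecs xs zero    = refl
length-allVecs xs (suc n) = begin
  length (allVecs xs (suc n))                         ≡⟨ cong length (allVecs-suc xs n) ⟩
  length (cartesianProductWith _∷_ xs (allVecs xs n)) ≡⟨ length-cartesianProductWith _∷_ xs _ ⟩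
  length xs * length (allVecs xs n)                   ≡⟨ cong (length xs *_) (length-allVecs xs n) ⟩
  length xs * length xs ^ n                           ∎
  where open ≡-Reasoning

∈-allQ : (v : QVertex n) → v ∈ allQ n
∈-allQ = ∈-allVecs λ { true → here refl ; false → there (here refl) }

allQ-unique : (n : ℕ) → Unique (allQ n)
allQ-unique = allVecs-unique (((λ ()) All.∷ All.[]) ∷ All.[] ∷ [])

length-allQ : (n : ℕ) → length (allQ n) ≡ 2 ^ n
length-allQ = length-allVecs (true ∷ false ∷ [])

Unique-⊆⇒length≤ : (xs ys : List A) → Unique xs → xs ⊆ ys → length xs ≤ length ys
Unique-⊆⇒length≤ []       ys _           _    = z≤n
Unique-⊆⇒length≤ (x ∷ xs) ys (x∉xs ∷ xs!) xs⊆ys with ∈-∃++ (xs⊆ys (here refl))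
... | ys₁ , ys₂ , refl = begin
  suc (length xs)                  ≤⟨ s≤s (Unique-⊆⇒length≤ xs (ys₁ List.++ ys₂) xs! xs⊆ys₁ys₂) ⟩
  suc (length (ys₁ List.++ ys₂))   ≡⟨ cong suc (Listₚ.length-++ ys₁) ⟩
  suc (length ys₁ + length ys₂)    ≡⟨ +-suc (length ys₁) (length ys₂) ⟨
  length ys₁ + length (x ∷ ys₂)    ≡⟨ Listₚ.length-++ ys₁ ⟨
  length (ys₁ List.++ x ∷ ys₂)     ∎
  where
  open ≤-Reasoning
  xs⊆ys₁ys₂ : xs ⊆ ys₁ List.++ ys₂
  xs⊆ys₁ys₂ v∈xs with ∈-++⁻ ys₁ (xs⊆ys (there v∈xs))
  ... | inj₁ v∈ys₁         = ∈-++⁺ˡ v∈ys₁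
  ... | inj₂ (here refl)   = ⊥-elim (All.lookup x∉xs v∈xs refl)
  ... | inj₂ (there v∈ys₂) = ∈-++⁺ʳ ys₁ v∈ys₂

-- Binary numerals and the Gray code

-- Most significant bit first; only meaningful for p < 2 ^ a.
toBin : (a : ℕ) → ℕ → Vec Bool a
toBin zero    p = []
toBin (suc a) p with p <? 2 ^ a
... | yes _ = false ∷ toBin a p
... | no  _ = true  ∷ toBin a (p ∸ 2 ^ a)

fromBin : Vec Bool n → ℕ
fromBin             []          = 0
fromBin             (false ∷ v) = fromBin v
fromBin {n = suc n} (true  ∷ v) = 2 ^ n + fromBin v

2^[1+a]≡2^a+2^a : ∀ a → 2 ^ suc a ≡ 2 ^ a + 2 ^ a
2^[1+a]≡2^a+2^a a = cong (2 ^ a +_) (+-identityʳ (2 ^ a))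

fromBin<2^n : (v : Vec Bool n) → fromBin v < 2 ^ n
fromBin<2^n []                      = s≤s z≤n
fromBin<2^n {n = suc n} (false ∷ v) = ≤-trans (fromBin<2^n v) (m≤m+n (2 ^ n) _)
fromBin<2^n {n = suc n} (true ∷ v) rewrite 2^[1+a]≡2^a+2^a n = +-monoʳ-< (2 ^ n) (fromBin<2^n v)

toBin-fromBin : (v : Vec Bool n) → toBin n (fromBin v) ≡ v
toBin-fromBin []                      = refl
toBin-fromBin {n = suc n} (false ∷ v) with fromBin v <? 2 ^ n
... | yes _   = cong (false ∷_) (toBin-fromBin v)
... | no  v≮  = contradiction (fromBin<2^n v) v≮
toBin-fromBin {n = suc n} (true ∷ v) with 2 ^ n + fromBin v <? 2 ^ n
... | yes v<  = contradiction v< (≤⇒≯ (m≤m+n (2 ^ n) _))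
... | no  _   = cong (true ∷_) (trans (cong (toBin n) (m+n∸m≡n (2 ^ n) (fromBin v))) (toBin-fromBin v))

fromBin-toBin : (a p : ℕ) → p < 2 ^ a → fromBin (toBin a p) ≡ p
fromBin-toBin zero    zero    _ = refl
fromBin-toBin zero    (suc p) (s≤s ())
fromBin-toBin (suc a) p p<2^1+a with p <? 2 ^ a
... | yes p<2^a = fromBin-toBin a p p<2^a
... | no  p≮2^a = trans (cong (2 ^ a +_) (fromBin-toBin a (p ∸ 2 ^ a) p∸2^a<2^a)) (m+[n∸m]≡n (≮⇒≥ p≮2^a))
  where
  p∸2^a<2^a : p ∸ 2 ^ a < 2 ^ a
  p∸2^a<2^a = +-cancelˡ-< (2 ^ a) _ _
    (subst₂ _<_ (sym (m+[n∸m]≡n (≮⇒≥ p≮2^a))) (2^[1+a]≡2^a+2^a a) p<2^1+a)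

toBin-0 : (a : ℕ) → toBin a 0 ≡ replicate a false
toBin-0 zero    = refl
toBin-0 (suc a) with 0 <? 2 ^ a
... | yes _   = cong (false ∷_) (toBin-0 a)
... | no  0≮  = contradiction (m^n>0 2 a) 0≮

toBin-2^a∸1 : (a p : ℕ) → suc p ≡ 2 ^ a → toBin a p ≡ replicate a true
toBin-2^a∸1 zero    p _ = refl
toBin-2^a∸1 (suc a) p 1+p≡2^1+a with p <? 2 ^ a
... | yes p<2^a = contradiction (subst (_≤ 2 ^ a) (trans 1+p≡2^1+a (2^[1+a]≡2^a+2^a a)) p<2^a)
                               (<⇒≱ (m<m+n (2 ^ a) (m^n>0 2 a)))
... | no  p≮2^a = cong (true ∷_) (toBin-2^a∸1 a (p ∸ 2 ^ a) 1+p∸2^a≡2^a)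
  where
  1+p∸2^a≡2^a : suc (p ∸ 2 ^ a) ≡ 2 ^ a
  1+p∸2^a≡2^a = begin
    suc (p ∸ 2 ^ a)       ≡⟨ +-∸-assoc 1 (≮⇒≥ p≮2^a) ⟨
    suc p ∸ 2 ^ a         ≡⟨ cong (_∸ 2 ^ a) (trans 1+p≡2^1+a (2^[1+a]≡2^a+2^a a)) ⟩
    2 ^ a + 2 ^ a ∸ 2 ^ a ≡⟨ m+n∸m≡n (2 ^ a) (2 ^ a) ⟩
    2 ^ a                 ∎
    where open ≡-Reasoning

-- Binary-reflected Gray code: each bit is xor-ed with the bit before it (the first one with c).
gray : Bool → Vec Bool n → Vec Bool n
gray c []      = []
gray c (b ∷ v) = (c xor b) ∷ gray b v

gray⁻¹ : Bool → Vec Bool n → Vec Bool n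
gray⁻¹ c []      = []
gray⁻¹ c (o ∷ v) = (c xor o) ∷ gray⁻¹ (c xor o) v

xor-cancelˡ : ∀ c b → c xor (c xor b) ≡ b
xor-cancelˡ c b = trans (sym (xor-assoc c c b)) (cong (_xor b) (xor-same c))

gray⁻¹-gray : (c : Bool) (v : Vec Bool n) → gray⁻¹ c (gray c v) ≡ v
gray⁻¹-gray c []      = refl
gray⁻¹-gray c (b ∷ v) rewrite xor-cancelˡ c b = cong (b ∷_) (gray⁻¹-gray b v)

gray-gray⁻¹ : (c : Bool) (v : Vec Bool n) → gray c (gray⁻¹ c v) ≡ v
gray-gray⁻¹ c []      = refl
gray-gray⁻¹ c (o ∷ v) rewrite xor-cancelˡ c o = cong (o ∷_) (gray-gray⁻¹ (c xor o) v)

gray-replicate : (c : Bool) (a : ℕ) → gray c (replicate a c) ≡ replicate a false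
gray-replicate c zero    = refl
gray-replicate c (suc a) = cong₂ _∷_ (xor-same c) (gray-replicate c a)

-- Crossing from 01…1 to 10…0 changes only the first Gray bit.
gray-ones≡gray-zeros : (a : ℕ) → gray false (replicate a true) ≡ gray true (replicate a false)
gray-ones≡gray-zeros zero    = refl
gray-ones≡gray-zeros (suc a) =
  cong (true ∷_) (trans (gray-replicate true a) (sym (gray-replicate false a)))

gray-toBin-adjacent : (a : ℕ) (c : Bool) (p : ℕ) → suc p < 2 ^ a →
  Adjᵛ _≢_ (gray c (toBin a p)) (gray c (toBin a (suc p)))
gray-toBin-adjacent zero    c p (s≤s ())
gray-toBin-adjacent (suc a) c p 2+p≤2^1+a with p <? 2 ^ a | suc p <? 2 ^ a
... | yes _     | yes 1+p<2^a = inj₂ (refl , gray-toBin-adjacent a false p 1+p<2^a)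
... | yes p<2^a | no  1+p≮2^a = inj₁ (first-bits≢ c , tails≡)
  where
  1+p≡2^a : suc p ≡ 2 ^ a
  1+p≡2^a = ≤-antisym p<2^a (≮⇒≥ 1+p≮2^a)
  first-bits≢ : ∀ c → c xor false ≢ c xor true
  first-bits≢ false ()
  first-bits≢ true  ()
  tails≡ : gray false (toBin a p) ≡ gray true (toBin a (suc p ∸ 2 ^ a))
  tails≡ = begin
    gray false (toBin a p)              ≡⟨ cong (gray false) (toBin-2^a∸1 a p 1+p≡2^a) ⟩
    gray false (replicate a true)       ≡⟨ gray-ones≡gray-zeros a ⟩
    gray true (replicate a false)       ≡⟨ cong (gray true) (toBin-0 a) ⟨
    gray true (toBin a 0)               ≡⟨ cong (gray true ∘ toBin a) (m≤n⇒m∸n≡0 (≤-reflexive 1+p≡2^a)) ⟨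
    gray true (toBin a (suc p ∸ 2 ^ a)) ∎
    where open ≡-Reasoning
... | no  p≮2^a | yes 1+p<2^a = contradiction (<⇒≤ 1+p<2^a) p≮2^a
... | no  p≮2^a | no  _       =
  inj₂ (refl , subst (λ z → Adjᵛ _≢_ (gray true (toBin a (p ∸ 2 ^ a))) (gray true (toBin a z)))
                     (sym (+-∸-assoc 1 (≮⇒≥ p≮2^a)))
                     (gray-toBin-adjacent a true (p ∸ 2 ^ a) 1+[p∸2^a]<2^a))
  where
  1+[p∸2^a]<2^a : suc (p ∸ 2 ^ a) < 2 ^ a
  1+[p∸2^a]<2^a = +-cancelˡ-< (2 ^ a) _ _
    (subst₂ _<_ (trans (cong suc (sym (m+[n∸m]≡n (≮⇒≥ p≮2^a)))) (sym (+-suc (2 ^ a) (p ∸ 2 ^ a))))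
                (2^[1+a]≡2^a+2^a a) 2+p≤2^1+a)

-- A decoder inverting all copies at once makes them injective and pairwise disjoint; the
-- vertices it rejects must all be listed in missed.
record Tiling (l t n : ℕ) : Set where
  field
    k               : ℕ
    copy            : Fin k → PPowVertex l t → QVertex n
    copy-adj        : ∀ i x y → Adjᵛ (PAdj l) x y → Adjᵛ _≢_ (copy i x) (copy i y)
    decode          : QVertex n → Maybe (Fin k × PPowVertex l t)
    decode-copy     : ∀ i x → decode (copy i x) ≡ just (i , x)
    copy-decode     : ∀ v i x → decode v ≡ just (i , x) → copy i x ≡ v
    missed          : List (QVertex n)
    missed-complete : ∀ v → decode v ≡ nothing → v ∈ missed

DisjointCover : (l t n B : ℕ) → Set
DisjointCover l t n B =
  Σ ℕ λ k → Σ (Fin k → Copy l t n) λ cs → PairwiseDisjoint cs × uncovered cs ≤ B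

DisjointCover-mono : ∀ {l t n B B′} → B ≤ B′ → DisjointCover l t n B → DisjointCover l t n B′
DisjointCover-mono B≤B′ (k , cs , disjoint , bound) = k , cs , disjoint , ≤-trans bound B≤B′

tiling⇒disjointCover : ∀ {l t n} (T : Tiling l t n) → DisjointCover l t n (length (Tiling.missed T))
tiling⇒disjointCover {l} {t} {n} T = k , cs , disjoint , uncovered≤missed
  where
  open Tiling T
  copy-injective : ∀ i j x y → copy i x ≡ copy j y → (i , x) ≡ (j , y)
  copy-injective i j x y eq =
    just-injective (trans (sym (decode-copy i x)) (trans (cong decode eq) (decode-copy j y)))
  cs : Fin k → Copy l t n
  cs i = record
    { f         = copy i
    ; injective = λ x y eq → cong proj₂ (copy-injective i i x y eq)
    ; edges     = λ x y adj → Adjᵛ⇒PowAdj (copy i x) (copy i y) (copy-adj i x y (PowAdj⇒Adjᵛ x y adj)) }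
  disjoint : PairwiseDisjoint cs
  disjoint i j i≢j x y eq = i≢j (cong proj₁ (copy-injective i j x y eq))
  Covered : QVertex n → Set
  Covered v = Any (λ i → Any (λ x → copy i x ≡ v) (allPPow l t)) (allFin k)
  Uncovered? : ∀ v → Dec (¬ Covered v)
  Uncovered? v = ¬? (any? (λ i → any? (λ x → Vecₚ.≡-dec _≟ᵇ_ (copy i x) v) (allPPow l t)) (allFin k))
  copy∈enumeration : ∀ v i x → copy i x ≡ v → Covered v
  copy∈enumeration v i x eq =
    Any.map (λ { refl → Any.map (λ { refl → eq }) (∈-allVecs ∈-allFin x) }) (∈-allFin i)
  uncovered⊆missed : filter Uncovered? (allQ n) ⊆ missed
  uncovered⊆missed {v} v∈ with decode v in eq
  ... | nothing      = missed-complete v eq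
  ... | just (i , x) = ⊥-elim (proj₂ (∈-filter⁻ Uncovered? {xs = allQ n} v∈)
                                      (copy∈enumeration v i x (copy-decode v i x eq)))
  uncovered≤missed : uncovered cs ≤ length missed
  uncovered≤missed = Unique-⊆⇒length≤ (filter Uncovered? (allQ n)) missed
                       (Uniqueₚ.filter⁺ Uncovered? (allQ-unique n)) uncovered⊆missed

pointTiling : ∀ l n → Tiling l 0 n
pointTiling l n = record
  { k               = 2 ^ n
  ; copy            = λ i _ → toBin n (toℕ i)
  ; copy-adj        = λ { _ [] [] () }
  ; decode          = λ v → just (fromℕ< (fromBin<2^n v) , [])
  ; decode-copy     = λ { i [] → cong (λ j → just (j , [])) (Finₚ.toℕ-injective (decode-copy i)) }
  ; copy-decode     = λ { v i [] refl →
                          trans (cong (toBin n) (Finₚ.toℕ-fromℕ< (fromBin<2^n v))) (toBin-fromBin v) }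
  ; missed          = []
  ; missed-complete = λ _ () }
  where
  decode-copy : (i : Fin (2 ^ n)) → toℕ (fromℕ< (fromBin<2^n (toBin n (toℕ i)))) ≡ toℕ i
  decode-copy i = trans (Finₚ.toℕ-fromℕ< _) (fromBin-toBin n (toℕ i) (Finₚ.toℕ<n i))

emptyTiling : ∀ l t n → Tiling l t n
emptyTiling l t n = record
  { k               = 0
  ; copy            = λ ()
  ; copy-adj        = λ ()
  ; decode          = λ _ → nothing
  ; decode-copy     = λ ()
  ; copy-decode     = λ _ _ _ ()
  ; missed          = allQ n
  ; missed-complete = λ v _ → ∈-allQ v }

-- The Gray code path of Q_a, cut into K copies of P_l and the leftover vertex of position K * l.
module GrayPaths {l a K : ℕ} (2^a≡1+Kl : 2 ^ a ≡ suc (K * l)) where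

  position : Fin K → Fin l → ℕ
  position j x = toℕ (combine j x)

  position<2^a : ∀ j x → position j x < 2 ^ a
  position<2^a j x = subst (position j x <_) (sym 2^a≡1+Kl) (m≤n⇒m≤1+n (Finₚ.toℕ<n (combine j x)))

  path : Fin K → Fin l → Vec Bool a
  path j x = gray false (toBin a (position j x))

  leftover : Vec Bool a
  leftover = gray false (toBin a (K * l))

  decodePosition : ℕ → Maybe (Fin K × Fin l)
  decodePosition p with p <? K * l
  ... | yes p<Kl = just (remQuot l (fromℕ< p<Kl))
  ... | no  _    = nothing

  rank : Vec Bool a → ℕ
  rank u = fromBin (gray⁻¹ false u)

  rank-gray : ∀ p → p < 2 ^ a → rank (gray false (toBin a p)) ≡ p
  rank-gray p p<2^a = trans (cong fromBin (gray⁻¹-gray false (toBin a p))) (fromBin-toBin a p p<2^a)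

  gray-rank : (u : Vec Bool a) → gray false (toBin a (rank u)) ≡ u
  gray-rank u = trans (cong (gray false) (toBin-fromBin (gray⁻¹ false u))) (gray-gray⁻¹ false u)

  decodePath : Vec Bool a → Maybe (Fin K × Fin l)
  decodePath u = decodePosition (rank u)

  decodePath-gray : ∀ p → p < 2 ^ a → decodePath (gray false (toBin a p)) ≡ decodePosition p
  decodePath-gray p p<2^a = cong decodePosition (rank-gray p p<2^a)

  decodePath-path : ∀ j x → decodePath (path j x) ≡ just (j , x)
  decodePath-path j x with position j x <? K * l | decodePath-gray (position j x) (position<2^a j x)
  ... | yes p<Kl | eq = trans eq (cong just
          (trans (cong (remQuot l) (Finₚ.fromℕ<-toℕ (combine j x) p<Kl)) (Finₚ.remQuot-combine j x)))
  ... | no  p≮Kl | _  = contradiction (Finₚ.toℕ<n (combine j x)) p≮Kl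

  decodePath-leftover : decodePath leftover ≡ nothing
  decodePath-leftover with K * l <? K * l | decodePath-gray (K * l) (subst (K * l <_) (sym 2^a≡1+Kl) ≤-refl)
  ... | yes Kl<Kl | _  = contradiction Kl<Kl (n≮n _)
  ... | no  _     | eq = eq

  decodePosition-sound : ∀ p j x → decodePosition p ≡ just (j , x) → position j x ≡ p
  decodePosition-sound p j x _  with p <? K * l
  decodePosition-sound p j x refl | yes p<Kl =
    trans (cong toℕ (Finₚ.combine-remQuot {K} l (fromℕ< p<Kl))) (Finₚ.toℕ-fromℕ< p<Kl)

  decodePosition-nothing : ∀ p → p < 2 ^ a → decodePosition p ≡ nothing → p ≡ K * l
  decodePosition-nothing p p<2^a _  with p <? K * l
  decodePosition-nothing p p<2^a () | yes _
  decodePosition-nothing p p<2^a _  | no p≮Kl = ≤-antisym (s≤s⁻¹ (subst (p <_) 2^a≡1+Kl p<2^a)) (≮⇒≥ p≮Kl)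

  path-decodePath : ∀ u j x → decodePath u ≡ just (j , x) → path j x ≡ u
  path-decodePath u j x eq =
    trans (cong (gray false ∘ toBin a) (decodePosition-sound _ j x eq)) (gray-rank u)

  decodePath-nothing : ∀ u → decodePath u ≡ nothing → u ≡ leftover
  decodePath-nothing u eq = trans (sym (gray-rank u))
    (cong (gray false ∘ toBin a) (decodePosition-nothing (rank u) (fromBin<2^n (gray⁻¹ false u)) eq))

  path-step : ∀ j x y → suc (toℕ x) ≡ toℕ y → Adjᵛ _≢_ (path j x) (path j y)
  path-step j x y 1+x≡y = subst (λ p → Adjᵛ _≢_ (path j x) (gray false (toBin a p))) 1+pos≡pos
    (gray-toBin-adjacent a false (position j x) (subst (_< 2 ^ a) (sym 1+pos≡pos) (position<2^a j y)))
    where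
    1+pos≡pos : suc (position j x) ≡ position j y
    1+pos≡pos = begin
      suc (toℕ (combine j x))  ≡⟨ cong suc (Finₚ.toℕ-combine j x) ⟩
      suc (l * toℕ j + toℕ x)  ≡⟨ +-suc (l * toℕ j) (toℕ x) ⟨
      l * toℕ j + suc (toℕ x)  ≡⟨ cong (l * toℕ j +_) 1+x≡y ⟩
      l * toℕ j + toℕ y        ≡⟨ Finₚ.toℕ-combine j y ⟨
      toℕ (combine j y)        ∎
      where open ≡-Reasoning

  path-adj : ∀ j x y → PAdj l x y → Adjᵛ _≢_ (path j x) (path j y)
  path-adj j x y (inj₁ 1+x≡y) = path-step j x y 1+x≡y
  path-adj j x y (inj₂ 1+y≡x) = Adjᵛ-sym ≢-sym (path-step j y x 1+y≡x)

module Extension {l a K : ℕ} (2^a≡1+Kl : 2 ^ a ≡ suc (K * l)) {s m : ℕ}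
                 (A : Tiling l s m) (R : Tiling l (suc s) m) where

  open GrayPaths {l} {a} {K} 2^a≡1+Kl
  private
    module A = Tiling A
    module R = Tiling R

  Index : Set
  Index = Fin (K * A.k + R.k)

  productIndex : Fin K → Fin A.k → Index
  productIndex j i = combine j i ↑ˡ R.k

  leftoverIndex : Fin R.k → Index
  leftoverIndex r = K * A.k ↑ʳ r

  data IndexView : Index → Set where
    inProduct  : ∀ j i → IndexView (productIndex j i)
    inLeftover : ∀ r → IndexView (leftoverIndex r)

  indexView : ∀ idx → IndexView idx
  indexView idx = subst IndexView (Finₚ.join-splitAt (K * A.k) R.k idx) (view (splitAt (K * A.k) idx))
    where
    view : ∀ z → IndexView (join (K * A.k) R.k z)
    view (inj₁ c) = subst (λ c → IndexView (c ↑ˡ R.k)) (Finₚ.combine-remQuot {K} A.k c)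
                          (inProduct (proj₁ (remQuot {K} A.k c)) (proj₂ (remQuot {K} A.k c)))
    view (inj₂ r) = inLeftover r

  copySplit : Fin (K * A.k) ⊎ Fin R.k → PPowVertex l (suc s) → QVertex (a + m)
  copySplit (inj₁ c) (x ∷ xs) with remQuot {K} A.k c
  ... | j , i = path j x ++ A.copy i xs
  copySplit (inj₂ r) x        = leftover ++ R.copy r x

  copy : Index → PPowVertex l (suc s) → QVertex (a + m)
  copy idx = copySplit (splitAt (K * A.k) idx)

  copy-product : ∀ j i x xs → copy (productIndex j i) (x ∷ xs) ≡ path j x ++ A.copy i xs
  copy-product j i x xs =
    trans (cong (λ z → copySplit z (x ∷ xs)) (Finₚ.splitAt-↑ˡ (K * A.k) (combine j i) R.k))
          (cong (λ (j , i) → path j x ++ A.copy i xs) (Finₚ.remQuot-combine {K} {A.k} j i))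

  copy-leftover : ∀ r x → copy (leftoverIndex r) x ≡ leftover ++ R.copy r x
  copy-leftover r x = cong (λ z → copySplit z x) (Finₚ.splitAt-↑ʳ (K * A.k) R.k r)

  decodeParts : Maybe (Fin K × Fin l) → Maybe (Fin A.k × PPowVertex l s) →
                Maybe (Fin R.k × PPowVertex l (suc s)) → Maybe (Index × PPowVertex l (suc s))
  decodeParts (just (j , x)) (just (i , xs)) _              = just (productIndex j i , x ∷ xs)
  decodeParts (just _)       nothing         _              = nothing
  decodeParts nothing        _               (just (r , x)) = just (leftoverIndex r , x)
  decodeParts nothing        _               nothing        = nothing

  decode : QVertex (a + m) → Maybe (Index × PPowVertex l (suc s))
  decode v = decodeParts (decodePath (take a v)) (A.decode (drop a v)) (R.decode (drop a v))

  decode-++ : ∀ u w → decode (u ++ w) ≡ decodeParts (decodePath u) (A.decode w) (R.decode w)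
  decode-++ u w =
    cong₂ (λ u w → decodeParts (decodePath u) (A.decode w) (R.decode w)) (take-++ u w) (drop-++ u w)

  decode-copy : ∀ idx x → decode (copy idx x) ≡ just (idx , x)
  decode-copy idx = byView (indexView idx)
    where
    byView : ∀ {idx} → IndexView idx → ∀ x → decode (copy idx x) ≡ just (idx , x)
    byView (inProduct j i) (x ∷ xs)
      rewrite copy-product j i x xs | decode-++ (path j x) (A.copy i xs) | decodePath-path j x | A.decode-copy i xs
      = refl
    byView (inLeftover r) x
      rewrite copy-leftover r x | decode-++ leftover (R.copy r x) | decodePath-leftover | R.decode-copy r x
      = refl

  copy-decodeParts : ∀ u w idx x → decodeParts (decodePath u) (A.decode w) (R.decode w) ≡ just (idx , x) →
                     copy idx x ≡ u ++ w
  copy-decodeParts u w idx x eq with decodePath u in p | A.decode w in q | R.decode w in r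
  copy-decodeParts u w _ _ refl | just (j , x) | just (i , xs) | _ =
    trans (copy-product j i x xs) (cong₂ _++_ (path-decodePath u j x p) (A.copy-decode w i xs q))
  copy-decodeParts u w _ _ refl | nothing | _ | just (r′ , x) =
    trans (copy-leftover r′ x) (cong₂ _++_ (sym (decodePath-nothing u p)) (R.copy-decode w r′ x r))

  copy-decode : ∀ v idx x → decode v ≡ just (idx , x) → copy idx x ≡ v
  copy-decode v idx x eq = trans (copy-decodeParts (take a v) (drop a v) idx x eq) (Vecₚ.take++drop≡id a v)

  missed : List (QVertex (a + m))
  missed = cartesianProductWith _++_ (allQ a) A.missed List.++ List.map (leftover ++_) R.missed

  missed-completeParts : ∀ u w → decodeParts (decodePath u) (A.decode w) (R.decode w) ≡ nothing →
                         u ++ w ∈ missed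
  missed-completeParts u w eq with decodePath u in p | A.decode w in q | R.decode w in r
  ... | just _  | nothing | _       =
    ∈-++⁺ˡ (∈-cartesianProductWith⁺ _++_ (∈-allQ u) (A.missed-complete w q))
  ... | nothing | _       | nothing =
    ∈-++⁺ʳ (cartesianProductWith _++_ (allQ a) A.missed)
      (subst (λ u → u ++ w ∈ List.map (leftover ++_) R.missed) (sym (decodePath-nothing u p))
             (∈-map⁺ (leftover ++_) (R.missed-complete w r)))

  missed-complete : ∀ v → decode v ≡ nothing → v ∈ missed
  missed-complete v eq =
    subst (_∈ missed) (Vecₚ.take++drop≡id a v) (missed-completeParts (take a v) (drop a v) eq)

  copy-adj : ∀ idx x y → Adjᵛ (PAdj l) x y → Adjᵛ _≢_ (copy idx x) (copy idx y)
  copy-adj idx = byView (indexView idx)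
    where
    byView : ∀ {idx} → IndexView idx → ∀ x y → Adjᵛ (PAdj l) x y → Adjᵛ _≢_ (copy idx x) (copy idx y)
    byView (inProduct j i) (x ∷ xs) (y ∷ ys) adj
      rewrite copy-product j i x xs | copy-product j i y ys with adj
    ... | inj₁ (x~y , refl)   = Adjᵛ-++ˡ (path j x) (path j y) (A.copy i xs) (path-adj j x y x~y)
    ... | inj₂ (refl , xs~ys) = Adjᵛ-++ʳ (path j x) (A.copy i xs) (A.copy i ys) (A.copy-adj i xs ys xs~ys)
    byView (inLeftover r) x y adj rewrite copy-leftover r x | copy-leftover r y =
      Adjᵛ-++ʳ leftover (R.copy r x) (R.copy r y) (R.copy-adj r x y adj)

  extendTiling : Tiling l (suc s) (a + m)
  extendTiling = record
    { k               = K * A.k + R.k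
    ; copy            = copy
    ; copy-adj        = copy-adj
    ; decode          = decode
    ; decode-copy     = decode-copy
    ; copy-decode     = copy-decode
    ; missed          = missed
    ; missed-complete = missed-complete }

  length-missed : length missed ≡ 2 ^ a * length A.missed + length R.missed
  length-missed = begin
    length missed
      ≡⟨ Listₚ.length-++ (cartesianProductWith _++_ (allQ a) A.missed) ⟩
    length (cartesianProductWith _++_ (allQ a) A.missed) + length (List.map (leftover ++_) R.missed)
      ≡⟨ cong₂ _+_ (length-cartesianProductWith _++_ (allQ a) A.missed)
                   (Listₚ.length-map (leftover ++_) R.missed) ⟩
    length (allQ a) * length A.missed + length R.missed
      ≡⟨ cong (λ z → z * length A.missed + length R.missed) (length-allQ a) ⟩
    2 ^ a * length A.missed + length R.missed ∎
    where open ≡-Reasoning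

-- Powers of 2 modulo an odd number

odd⇒coprime-2 : ∀ {l} → l % 2 ≡ 1 → Coprime l 2
odd⇒coprime-2 l-odd {zero}                (_ , 0∣2)  = contradiction (0∣⇒≡0 0∣2) λ ()
odd⇒coprime-2 l-odd {suc zero}            _          = refl
odd⇒coprime-2 l-odd {suc (suc zero)}      (2∣l , _)  = contradiction (trans (sym l-odd) (n∣m⇒m%n≡0 _ 2 2∣l)) λ ()
odd⇒coprime-2 l-odd {suc (suc (suc _))}   (_ , i∣2)  = contradiction (∣⇒≤ i∣2) λ { (s≤s (s≤s ())) }

coprime-2⇒∣2^i*n⇒∣n : ∀ {l} i {z} → Coprime l 2 → l ∣ 2 ^ i * z → l ∣ z
coprime-2⇒∣2^i*n⇒∣n {l} zero    {z} _        l∣ = subst (l ∣_) (*-identityˡ z) l∣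
coprime-2⇒∣2^i*n⇒∣n {l} (suc i) {z} coprime l∣ =
  coprime-2⇒∣2^i*n⇒∣n i coprime (coprime-divisor coprime (subst (l ∣_) (*-assoc 2 (2 ^ i) z) l∣))

%≡%⇒∣∸ : ∀ l x y .{{_ : NonZero l}} → x % l ≡ y % l → x ≤ y → l ∣ y ∸ x
%≡%⇒∣∸ l x y x≡y x≤y = divides (y / l ∸ x / l) (begin
  y ∸ x                                      ≡⟨ cong₂ _∸_ (m≡m%n+[m/n]*n y l) (m≡m%n+[m/n]*n x l) ⟩
  (y % l + y / l * l) ∸ (x % l + x / l * l)  ≡⟨ cong (λ r → (r + y / l * l) ∸ (x % l + x / l * l)) x≡y ⟨
  (x % l + y / l * l) ∸ (x % l + x / l * l)  ≡⟨ [m+n]∸[m+o]≡n∸o (x % l) _ _ ⟩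
  y / l * l ∸ x / l * l                      ≡⟨ *-distribʳ-∸ l (y / l) (x / l) ⟨
  (y / l ∸ x / l) * l                        ∎)
  where open ≡-Reasoning

-- Two of 2^0, …, 2^l agree modulo l, say 2^i and 2^(i+d); then l divides 2^i (2^d − 1), hence 2^d − 1.
odd⇒2^a≡1+K*l : ∀ {l} → l % 2 ≡ 1 → Σ ℕ λ a → Σ ℕ λ K → 2 ^ a ≡ suc (K * l) × 1 ≤ a
odd⇒2^a≡1+K*l {l@(suc _)} l-odd with Finₚ.pigeonhole (n<1+n l) (λ i → fromℕ< (m%n<n (2 ^ toℕ i) l))
... | i , j , i<j , 2^i≡2^j = d , (2 ^ d ∸ 1) / l , 2^d≡1+Kl , m<n⇒0<n∸m i<j
  where
  d : ℕ
  d = toℕ j ∸ toℕ i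
  2^j≡2^i*2^d : 2 ^ toℕ j ≡ 2 ^ toℕ i * 2 ^ d
  2^j≡2^i*2^d = trans (cong (2 ^_) (sym (m+[n∸m]≡n (<⇒≤ i<j)))) (^-distribˡ-+-* 2 (toℕ i) d)
  2^j∸2^i≡2^i*[2^d∸1] : 2 ^ toℕ j ∸ 2 ^ toℕ i ≡ 2 ^ toℕ i * (2 ^ d ∸ 1)
  2^j∸2^i≡2^i*[2^d∸1] = begin
    2 ^ toℕ j ∸ 2 ^ toℕ i                ≡⟨ cong (_∸ 2 ^ toℕ i) 2^j≡2^i*2^d ⟩
    2 ^ toℕ i * 2 ^ d ∸ 2 ^ toℕ i        ≡⟨ cong (2 ^ toℕ i * 2 ^ d ∸_) (*-identityʳ (2 ^ toℕ i)) ⟨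
    2 ^ toℕ i * 2 ^ d ∸ 2 ^ toℕ i * 1    ≡⟨ *-distribˡ-∸ (2 ^ toℕ i) (2 ^ d) 1 ⟨
    2 ^ toℕ i * (2 ^ d ∸ 1)              ∎
    where open ≡-Reasoning
  2^i%l≡2^j%l : 2 ^ toℕ i % l ≡ 2 ^ toℕ j % l
  2^i%l≡2^j%l = trans (sym (Finₚ.toℕ-fromℕ< _)) (trans (cong toℕ 2^i≡2^j) (Finₚ.toℕ-fromℕ< _))
  l∣2^d∸1 : l ∣ 2 ^ d ∸ 1
  l∣2^d∸1 = coprime-2⇒∣2^i*n⇒∣n (toℕ i) (odd⇒coprime-2 l-odd)
    (subst (l ∣_) 2^j∸2^i≡2^i*[2^d∸1] (%≡%⇒∣∸ l _ _ 2^i%l≡2^j%l (^-monoʳ-≤ 2 (<⇒≤ i<j))))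
  2^d≡1+Kl : 2 ^ d ≡ suc ((2 ^ d ∸ 1) / l * l)
  2^d≡1+Kl = sym (trans (cong suc (m/n*n≡m l∣2^d∸1)) (m+[n∸m]≡n (m^n>0 2 d)))

[m*n]^o≡m^o*n^o : ∀ m n o → (m * n) ^ o ≡ m ^ o * n ^ o
[m*n]^o≡m^o*n^o m n zero    = refl
[m*n]^o≡m^o*n^o m n (suc o) =
  trans (cong ((m * n) *_) ([m*n]^o≡m^o*n^o m n o)) (interchange m n (m ^ o) (n ^ o))
  where
  interchange : ∀ w x y z → (w * x) * (y * z) ≡ (w * y) * (x * z)
  interchange = solve-∀

1+n/a≤2*n : ∀ n a .{{_ : NonZero a}} → 1 ≤ n → suc (n / a) ≤ 2 * n
1+n/a≤2*n n a 1≤n = subst (suc (n / a) ≤_) (cong (n +_) (sym (+-identityʳ n))) (+-mono-≤ 1≤n (m/n≤m n a))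

module Recursion {l a K : ℕ} (2^a≡1+Kl : 2 ^ a ≡ suc (K * l)) where

  open Extension {l} {a} {K} 2^a≡1+Kl using (extendTiling; length-missed)

  -- q * a + r, by recursion on q so that dim (suc q) r is a + dim q r on the nose.
  dim : ℕ → ℕ → ℕ
  dim zero    r = r
  dim (suc q) r = a + dim q r

  dim≡ : ∀ q r → dim q r ≡ q * a + r
  dim≡ zero    r = refl
  dim≡ (suc q) r = trans (cong (a +_) (dim≡ q r)) (sym (+-assoc a (q * a) r))

  tiling : ∀ t q r → Tiling l t (dim q r)
  tiling zero    q       r = pointTiling l (dim q r)
  tiling (suc s) zero    r = emptyTiling l (suc s) r
  tiling (suc s) (suc q) r = extendTiling (tiling s q r) (tiling (suc s) q r)

  missedBound : ℕ → ℕ → ℕ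
  missedBound zero    q = 0
  missedBound (suc s) q = (2 ^ a) ^ suc s * suc q ^ s

  missedBound-step : ∀ s q → 2 ^ a * missedBound s q + missedBound (suc s) q ≤ missedBound (suc s) (suc q)
  missedBound-step zero    q = ≤-reflexive (cong (_+ (2 ^ a) ^ 1 * 1) (*-zeroʳ (2 ^ a)))
  missedBound-step (suc s) q = begin
    D * (D ^ suc s * X) + D ^ suc (suc s) * (suc q * X)
      ≡⟨ cong (_+ D ^ suc (suc s) * (suc q * X)) (*-assoc D (D ^ suc s) X) ⟨
    D ^ suc (suc s) * X + D ^ suc (suc s) * (suc q * X)
      ≡⟨ *-distribˡ-+ (D ^ suc (suc s)) X (suc q * X) ⟨
    D ^ suc (suc s) * (suc (suc q) * X)
      ≤⟨ *-monoʳ-≤ (D ^ suc (suc s)) (*-monoʳ-≤ (suc (suc q)) (^-monoˡ-≤ s (n≤1+n (suc q)))) ⟩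
    D ^ suc (suc s) * (suc (suc q) * suc (suc q) ^ s)    ∎
    where
    open ≤-Reasoning
    D X : ℕ
    D = 2 ^ a
    X = suc q ^ s

  length-missed-tiling : ∀ t q r → r ≤ a → length (Tiling.missed (tiling t q r)) ≤ missedBound t q
  length-missed-tiling zero    q       r r≤a = z≤n
  length-missed-tiling (suc s) zero    r r≤a = begin
    length (allQ r)        ≡⟨ length-allQ r ⟩
    2 ^ r                  ≤⟨ ^-monoʳ-≤ 2 r≤a ⟩
    2 ^ a                  ≤⟨ m≤m*n (2 ^ a) ((2 ^ a) ^ s) {{m^n≢0 (2 ^ a) s {{m^n≢0 2 a}}}} ⟩
    (2 ^ a) ^ suc s        ≡⟨ *-identityʳ _ ⟨
    (2 ^ a) ^ suc s * 1    ≡⟨ cong ((2 ^ a) ^ suc s *_) (^-zeroˡ s) ⟨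
    missedBound (suc s) 0  ∎
    where open ≤-Reasoning
  length-missed-tiling (suc s) (suc q) r r≤a = begin
    length (Tiling.missed (tiling (suc s) (suc q) r))
      ≡⟨ length-missed (tiling s q r) (tiling (suc s) q r) ⟩
    2 ^ a * length (Tiling.missed (tiling s q r)) + length (Tiling.missed (tiling (suc s) q r))
      ≤⟨ +-mono-≤ (*-monoʳ-≤ (2 ^ a) (length-missed-tiling s q r r≤a)) (length-missed-tiling (suc s) q r r≤a) ⟩
    2 ^ a * missedBound s q + missedBound (suc s) q
      ≤⟨ missedBound-step s q ⟩
    missedBound (suc s) (suc q) ∎
    where open ≤-Reasoning

  module _ .{{_ : NonZero a}} where

    dim-div-mod : ∀ n → dim (n / a) (n % a) ≡ n
    dim-div-mod n =
      trans (dim≡ (n / a) (n % a)) (trans (+-comm (n / a * a) (n % a)) (sym (m≡m%n+[m/n]*n n a)))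

    missedBound-div≤ : ∀ s n → 1 ≤ n → missedBound (suc s) (n / a) ≤ (2 ^ a) ^ suc s * 2 ^ s * n ^ s
    missedBound-div≤ s n 1≤n = begin
      D ^ suc s * suc (n / a) ^ s  ≤⟨ *-monoʳ-≤ (D ^ suc s) (^-monoˡ-≤ s (1+n/a≤2*n n a 1≤n)) ⟩
      D ^ suc s * (2 * n) ^ s      ≡⟨ cong (D ^ suc s *_) ([m*n]^o≡m^o*n^o 2 n s) ⟩
      D ^ suc s * (2 ^ s * n ^ s)  ≡⟨ *-assoc (D ^ suc s) (2 ^ s) (n ^ s) ⟨
      D ^ suc s * 2 ^ s * n ^ s    ∎
      where
      open ≤-Reasoning
      D : ℕ
      D = 2 ^ a

    disjointCover : ∀ s n → 1 ≤ n → DisjointCover l (suc s) n ((2 ^ a) ^ suc s * 2 ^ s * n ^ s)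
    disjointCover s n 1≤n = subst (λ m → DisjointCover l (suc s) m _) (dim-div-mod n)
      (DisjointCover-mono missed≤ (tiling⇒disjointCover (tiling (suc s) q r)))
      where
      q r : ℕ
      q = n / a
      r = n % a
      missed≤ : length (Tiling.missed (tiling (suc s) q r)) ≤ (2 ^ a) ^ suc s * 2 ^ s * n ^ s
      missed≤ = ≤-trans (length-missed-tiling (suc s) q r (<⇒≤ (m%n<n n a))) (missedBound-div≤ s n 1≤n)

mainTheorem7 : (l t : ℕ) → l % 2 ≡ 1 → 1 ≤ t →
    Σ ℕ λ C → (n : ℕ) → 1 ≤ n →
    Σ ℕ λ k → Σ (Fin k → Copy l t n) λ cs →
    PairwiseDisjoint cs × uncovered cs ≤ C * n ^ (t ∸ 1)
mainTheorem7 l (suc s) l-odd _ with odd⇒2^a≡1+K*l l-odd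
... | a , K , 2^a≡1+Kl , 1≤a = (2 ^ a) ^ suc s * 2 ^ s , disjointCover s
  where
  open Recursion {l} {a} {K} 2^a≡1+Kl
  instance
    a≢0 : NonZero a
    a≢0 = >-nonZero 1≤a
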